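{- The following equations are derivable by equational logic from $\mathrm{EqFFEL}$: (1) $x \wedge^{\bullet} (y \wedge^{\bullet} \mathsf{F}) = \neg x \wedge^{\bullet} (y \wedge^{\bullet} \mathsf{F})$; (2) $(x \vee^{\bullet} \mathsf{T}) \wedge^{\bullet} y = \neg(x \vee^{\bullet} \mathsf{T}) \vee^{\bullet} y$; (3) $x \vee^{\bullet} (y \wedge^{\bullet} (z \vee^{\bullet} \mathsf{T})) = (x \vee^{\bullet} y) \wedge^{\bullet} (z \vee^{\bullet} \mathsf{T})$.
   Context: Terms are built from variables, constants $\mathsf{T}, \mathsf{F}$, negation $\neg$, and binary connectives $\wedge^{\bullet}$ (full left-sequential conjunction) and $\vee^{\bullet}$ (full left-sequential disjunction). $\mathrm{EqFFEL}$ is the set of equations: $\mathsf{F} = \neg\mathsf{T}$; $x \vee^{\bullet} y = \neg(\neg x \wedge^{\bullet} \neg y)$; $\neg\neg x = x$; $(x \wedge^{\bullet} y) \wedge^{\bullet} z = x \wedge^{\bullet} (y \wedge^{\bullet} z)$; $\mathsf{T} \wedge^{\bullet} x = x$; $x \wedge^{\bullet} \mathsf{T} = x$; $x \wedge^{\bullet} \mathsf{F} = \mathsf{F} \wedge^{\bullet} x$; $x \wedge^{\bullet} \mathsf{F} = \neg x \wedge^{\bullet} \mathsf{F}$; $(x \wedge^{\bullet} \mathsf{F}) \vee^{\bullet} y = (x \vee^{\bullet} \mathsf{T}) \wedge^{\bullet} y$; $x \vee^{\bullet} (y \wedge^{\bullet} \mathsf{F}) = x \wedge^{\bullet} (y \vee^{\bullet}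 \mathsf{T})$. -}

module Defs where

open import Data.Nat using (ℕ)

infixr 6 _∧•_
infixr 5 _∨•_
data Term : Set where
  var  : ℕ → Term
  T F  : Term
  ¬'_  : Term → Term
  _∧•_ : Term → Term → Term
  _∨•_ : Term → Term → Term

-- Axiom instances are given with arbitrary terms substituted for x, y, z
-- (which is equivalent to closing the axioms under substitution,
-- since substitution commutes with the other rules).
infix 4 _≈_
data _≈_ : Term → Term → Set where
  ax-F      : F ≈ ¬' T
  ax-or     : ∀ x y → x ∨• y ≈ ¬' (¬' x ∧• ¬' y)
  ax-neg    : ∀ x → ¬' (¬' x) ≈ x
  ax-assoc  : ∀ x y z → (x ∧• y) ∧• z ≈ x ∧• (y ∧• z)
  ax-unitˡ  : ∀ x → T ∧• x ≈ x
  ax-unitʳ  : ∀ x → x ∧• T ≈ x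
  ax-F1     : ∀ x → x ∧• F ≈ F ∧• x
  ax-F2     : ∀ x → x ∧• F ≈ ¬' x ∧• F
  ax-F3     : ∀ x y → (x ∧• F) ∨• y ≈ (x ∨• T) ∧• y
  ax-F4     : ∀ x y → x ∨• (y ∧• F) ≈ x ∧• (y ∨• T)
  refl'     : ∀ {t} → t ≈ t
  sym'      : ∀ {s t} → s ≈ t → t ≈ s
  trans'    : ∀ {s t u} → s ≈ t → t ≈ u → s ≈ u
  cong-¬    : ∀ {s t} → s ≈ t → ¬' s ≈ ¬' t
  cong-∧    : ∀ {s s' t t'} → s ≈ s' → t ≈ t' → s ∧• t ≈ s' ∧• t'
  cong-∨    : ∀ {s s' t t'} → s ≈ s' → t ≈ t' → s ∨• t ≈ s' ∨• t'

module Submission where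

-- All three follow from a few general consequences of EqFFEL:
--   * ¬ (x ∨• T) ≈ x ∧• F: since F ≈ ¬T, the axiom for ∨• gives
--     ¬(x ∨• T) ≈ ¬x ∧• F, and ax-F2 lets the negation on x be dropped;
--   * De Morgan ¬ (x ∨• y) ≈ ¬x ∧• ¬y, and hence associativity of ∨•,
--     inherited from associativity of ∧• through the De Morgan laws.
-- Law (1) moves y ∧• F to F ∧• y so that x meets F directly and ax-F2 applies;
-- law (2) is ax-F3 read backwards after rewriting x ∧• F as ¬(x ∨• T);
-- law (3) writes y ∧• (z ∨• T) as y ∨• (z ∧• F) via ax-F4, reassociates the
-- disjunction, and applies ax-F4 again.

open import Defs
open import Data.Product using (_×_; _,_)
open import Relation.Binary.Bundles using (Setoid)
open import Level using (0ℓ)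

≈-setoid : Setoid 0ℓ 0ℓ
≈-setoid = record
  { Carrier       = Term
  ; _≈_           = _≈_
  ; isEquivalence = record { refl = refl' ; sym = sym' ; trans = trans' }
  }

open import Relation.Binary.Reasoning.Setoid ≈-setoid

-- A conjunction ending in F may have its left conjunct negated:
-- F commutes to the front of y, where ax-F2 applies to x ∧• F.
∧F-neg : ∀ x y → x ∧• (y ∧• F) ≈ ¬' x ∧• (y ∧• F)
∧F-neg x y = begin
  x ∧• (y ∧• F)      ≈⟨ cong-∧ refl' (ax-F1 y) ⟩
  x ∧• (F ∧• y)      ≈⟨ sym' (ax-assoc x F y) ⟩
  (x ∧• F) ∧• y      ≈⟨ cong-∧ (ax-F2 x) refl' ⟩
  (¬' x ∧• F) ∧• y   ≈⟨ ax-assoc (¬' x) F y ⟩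
  ¬' x ∧• (F ∧• y)   ≈⟨ cong-∧ refl' (sym' (ax-F1 y)) ⟩
  ¬' x ∧• (y ∧• F)   ∎

¬-∨ : ∀ x y → ¬' (x ∨• y) ≈ ¬' x ∧• ¬' y
¬-∨ x y = begin
  ¬' (x ∨• y)              ≈⟨ cong-¬ (ax-or x y) ⟩
  ¬' (¬' (¬' x ∧• ¬' y))   ≈⟨ ax-neg (¬' x ∧• ¬' y) ⟩
  ¬' x ∧• ¬' y             ∎

¬-∨T : ∀ x → ¬' (x ∨• T) ≈ x ∧• F
¬-∨T x = begin
  ¬' (x ∨• T)     ≈⟨ ¬-∨ x T ⟩
  ¬' x ∧• ¬' T    ≈⟨ cong-∧ refl' (sym' ax-F) ⟩
  ¬' x ∧• F       ≈⟨ sym' (ax-F2 x) ⟩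
  x ∧• F          ∎

∨-assoc : ∀ x y w → x ∨• (y ∨• w) ≈ (x ∨• y) ∨• w
∨-assoc x y w = begin
  x ∨• (y ∨• w)                   ≈⟨ ax-or x (y ∨• w) ⟩
  ¬' (¬' x ∧• ¬' (y ∨• w))        ≈⟨ cong-¬ (cong-∧ refl' (¬-∨ y w)) ⟩
  ¬' (¬' x ∧• (¬' y ∧• ¬' w))     ≈⟨ cong-¬ (sym' (ax-assoc (¬' x) (¬' y) (¬' w))) ⟩
  ¬' ((¬' x ∧• ¬' y) ∧• ¬' w)     ≈⟨ cong-¬ (cong-∧ (sym' (¬-∨ x y)) refl') ⟩
  ¬' (¬' (x ∨• y) ∧• ¬' w)        ≈⟨ sym' (ax-or (x ∨• y) w) ⟩
  (x ∨• y) ∨• w                   ∎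

∨T-∧ : ∀ x y → (x ∨• T) ∧• y ≈ ¬' (x ∨• T) ∨• y
∨T-∧ x y = begin
  (x ∨• T) ∧• y       ≈⟨ sym' (ax-F3 x y) ⟩
  (x ∧• F) ∨• y       ≈⟨ cong-∨ (sym' (¬-∨T x)) refl' ⟩
  ¬' (x ∨• T) ∨• y    ∎

∨-∧∨T : ∀ x y z → x ∨• (y ∧• (z ∨• T)) ≈ (x ∨• y) ∧• (z ∨• T)
∨-∧∨T x y z = begin
  x ∨• (y ∧• (z ∨• T))    ≈⟨ cong-∨ refl' (sym' (ax-F4 y z)) ⟩
  x ∨• (y ∨• (z ∧• F))    ≈⟨ ∨-assoc x y (z ∧• F) ⟩
  (x ∨• y) ∨• (z ∧• F)    ≈⟨ ax-F4 (x ∨• y) z ⟩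
  (x ∨• y) ∧• (z ∨• T)    ∎

mainTheorem8 : (x y z : Term)
    → (x ∧• (y ∧• F) ≈ ¬' x ∧• (y ∧• F))
    × ((x ∨• T) ∧• y ≈ ¬' (x ∨• T) ∨• y)
    × (x ∨• (y ∧• (z ∨• T)) ≈ (x ∨• y) ∧• (z ∨• T))
mainTheorem8 x y z = ∧F-neg x y , ∨T-∧ x y , ∨-∧∨T x y z
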